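{- For every finite alphabet $\Sigma$ and every positive integer $w$, the binary relation $\mathcal{R}_{\in}(\Sigma,w)=\{(D,s): D\in\mathcal{B}(\Sigma,w)^{\circledast},\ s\in L(D)\}$ is regular.
   Context: Fix a padding symbol $\#$ not in any alphabet. A relation $R\subseteq\Gamma_1^+\times\cdots\times\Gamma_a^+$ is regular if the language $\{u_1\otimes\cdots\otimes u_a:(u_1,\dots,u_a)\in R\}$ is accepted by a finite automaton, where $u_1\otimes\cdots\otimes u_a$ is the string of length $\max_i|u_i|$ over $(\Gamma_1\sqcup\{\#\})\times\cdots\times(\Gamma_a\sqcup\{\#\})$ whose $j$-th symbol is the tuple of $j$-th symbols of the $u_i$, with $\#$ in place of missing symbols. ODDs. A $(\Sigma,w)$-layer is a tuple $B=(\ell,r,T,I,F,\iota,\phi)$ with $\ell,r\subseteq\{0,\dots,w-1\}$, $T\subseteq\ell\times(\Sigma\sqcup\{\#\})\times r$, $I\subseteq\ell$, $F\subseteq r$, Booleans $\iota,\phi$, $I=\emptyset$ if $\iota$ is false and $F=\emptyset$ if $\phi$ is false; $\mathcal{B}(\Sigma,w)$ is the set of all such layers, an alphabet. A $(\Sigma,w)$-ODD of length $k$ is a string $B_1\cdots B_k$ over $\mathcal{B}(\Sigma,w)$ with $\ell(B_{i+1})=r(B_i)$, $\iota(B_i)$ true iff $i=1$, $\phi(B_i)$ true iff $i=k$; $\mathcal{B}(\Sigma,w)^{\circledast}$ is the set of all $(\Sigma,w)$-ODDs of all lengths. A nonempty string $\sigma_1\cdots\sigma_{k'}$ over $\Sigma$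 with $k'\le k$ is accepted by $D$ if, setting $\hat\sigma_i=\sigma_i$ for $i\le k'$ and $\hat\sigma_i=\#$ otherwise, there are transitions $(p_i,\hat\sigma_i,q_i)\in T(B_i)$ with $p_{i+1}=q_i$, $p_1\in I(B_1)$, $q_k\in F(B_k)$; $L(D)$ is the set of accepted strings. -}

module Defs where

open import Data.Nat using (ℕ; zero; suc; _≤_; _∸_)
open import Data.Fin using (Fin)
open import Data.Bool using (Bool; true; false)
open import Data.Maybe using (Maybe; just; nothing)
open import Data.List using (List; []; _∷_; length; map; replicate; _++_)
open import Data.Product using (Σ; ∃; _×_; _,_)
open import Relation.Binary.PropositionalEquality using (_≡_)
open import Function.Bundles using (_⇔_)

-- Padded symbols: `nothing` plays the role of the padding symbol #.

Padded : Set → Set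
Padded A = Maybe A

NonEmpty : {A : Set} → List A → Set
NonEmpty xs = Σ _ λ y → Σ _ λ ys → xs ≡ y ∷ ys

_⊗_ : {A B : Set} → List A → List B → List (Padded A × Padded B)
[]       ⊗ []       = []
[]       ⊗ (b ∷ bs) = (nothing , just b) ∷ ([] ⊗ bs)
(a ∷ as) ⊗ []       = (just a , nothing) ∷ (as ⊗ [])
(a ∷ as) ⊗ (b ∷ bs) = (just a , just b) ∷ (as ⊗ bs)

record DFA (A : Set) : Set where
  field
    states : ℕ
    start  : Fin states
    δ      : Fin states → A → Fin states
    final  : Fin states → Bool

runDFA : {A : Set} (M : DFA A) → List A → Fin (DFA.states M) → Fin (DFA.states M)
runDFA M []       q = q
runDFA M (a ∷ as) q = runDFA M as (DFA.δ M q a)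

Accepts : {A : Set} → DFA A → List A → Set
Accepts M xs = DFA.final M (runDFA M xs (DFA.start M)) ≡ true

RegularRel : {Γ₁ Γ₂ : Set} → (List Γ₁ → List Γ₂ → Set) → Set
RegularRel {Γ₁} {Γ₂} R =
  Σ (DFA (Padded Γ₁ × Padded Γ₂)) λ M →
    (x : List (Padded Γ₁ × Padded Γ₂)) →
      Accepts M x ⇔
        (Σ (List Γ₁) λ u → Σ (List Γ₂) λ v →
           NonEmpty u × NonEmpty v × R u v × (x ≡ u ⊗ v))

-- (Σ,w)-layers, with Σ = Fin n and states {0,…,w-1} = Fin w.
-- Subsets of Fin w are represented by characteristic functions.

record Layer (n w : ℕ) : Set where
  field
    ℓ r  : Fin w → Bool
    T    : Fin w → Padded (Fin n) → Fin w → Bool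
    I F  : Fin w → Bool
    ι φ  : Bool
    T⊆   : ∀ p a q → T p a q ≡ true → (ℓ p ≡ true) × (r q ≡ true)
    I⊆ℓ  : ∀ p → I p ≡ true → ℓ p ≡ true
    F⊆r  : ∀ q → F q ≡ true → r q ≡ true
    ¬ι⇒I : ι ≡ false → ∀ p → I p ≡ false
    ¬φ⇒F : φ ≡ false → ∀ q → F q ≡ false

open Layer

_⟺_ : Bool → Set → Set
b ⟺ P = (b ≡ true) ⇔ P

data Chain {n w : ℕ} : List (Layer n w) → Set where
  []  : Chain []
  [_] : ∀ B → Chain (B ∷ [])
  _∷_ : ∀ {B B' Bs} → (∀ p → ℓ B' p ≡ r B p) → Chain (B' ∷ Bs) → Chain (B ∷ B' ∷ Bs)

data Position {A : Set} : List A → ℕ → A → Set where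
  here  : ∀ {x xs} → Position (x ∷ xs) 1 x
  there : ∀ {x y xs i} → Position xs i y → Position (x ∷ xs) (suc i) y

IsODD : {n w : ℕ} → List (Layer n w) → Set
IsODD {n} {w} D =
  Chain D ×
  (∀ i (B : Layer n w) → Position D i B →
     (ι B ⟺ (i ≡ 1)) × (φ B ⟺ (i ≡ length D)))

data RunFrom {n w : ℕ} : Fin w → List (Layer n w) → List (Padded (Fin n)) → Set where
  last : ∀ {B p q a} → T B p a q ≡ true → F B q ≡ true →
         RunFrom p (B ∷ []) (a ∷ [])
  step : ∀ {B Bs p q a as} → T B p a q ≡ true → RunFrom q Bs as →
         RunFrom p (B ∷ Bs) (a ∷ as)

pad : {A : Set} → ℕ → List A → List (Padded A)
pad k s = map just s ++ replicate (k ∸ length s) nothing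

InL : {n w : ℕ} → List (Layer n w) → List (Fin n) → Set
InL {n} {w} D s =
  NonEmpty s × (length s ≤ length D) ×
  (Σ (Fin w) λ p → Σ (Layer n w) λ B₁ →
     Position D 1 B₁ × (I B₁ p ≡ true) × RunFrom p D (pad (length D) s))

R∈ : (n w : ℕ) → List (Layer n w) → List (Fin n) → Set
R∈ n w D s = IsODD D × InL D s

-- Reading D ⊗ s one layer at a time, three finite automata run in parallel.  The first
-- checks that D is an ODD, for which it suffices to remember the right states and the
-- final flag of the previous layer; the second, that the string track is a nonempty
-- string followed by padding; the third, that D accepts the padded string, by the subset
-- construction: it tracks the set of ODD states reachable so far.

module Submission where

open import Defs
open import Data.Nat using (ℕ; suc; _<_; _≤_; z≤n; s≤s)
open import Data.Nat.Properties using (suc-injective)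
open import Data.Bool using (Bool; true; false)
import Data.Bool.Properties as Bool
open import Data.Empty using (⊥)
open import Data.Fin using (Fin)
open import Data.Fin.Properties using (1↔⊤; 2↔Bool; +↔⊎; *↔×; all?; any?)
open import Data.Fin.Subset using (Subset; _∈_)
open import Data.Fin.Subset.Properties using (_∈?_)
open import Data.List using (List; []; _∷_; map; length)
open import Data.List.Properties using (∷-injective; length-map)
open import Data.Maybe using (Maybe; just; nothing; maybe′)
import Data.Maybe as Maybe
open import Data.Maybe.Properties using (just-injective)
open import Data.Product using (Σ; _×_; _,_; proj₁; proj₂; map₁)
open import Data.Product.Function.NonDependent.Propositional using (_×-↔_; _×-⇔_)
open import Data.Sum using (_⊎_; inj₁; inj₂)
open import Data.Sum.Function.Propositional using (_⊎-↔_)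
open import Data.Unit using (⊤; tt)
open import Data.Vec using (tabulate; lookup)
open import Data.Vec.Properties using (lookup∘tabulate; []=↔lookup)
open import Data.Vec.Recursive using (lift↔; Fin[m^n]↔Fin[m]^n)
open import Data.Vec.Recursive.Properties using (↔Vec)
open import Function using (_∘_)
open import Function.Bundles using (_⇔_; _↔_; mk⇔; Inverse; Equivalence)
open import Function.Properties.Inverse using (↔-trans; ↔⇒⇔)
import Function.Properties.Equivalence as ⇔
open import Relation.Binary.PropositionalEquality
open import Relation.Nullary using (Dec; yes; no; does; ¬_; _×-dec_)
open import Relation.Nullary.Negation using (contradiction)
open import Relation.Unary using (Decidable)

does⇔ : {P : Set} (P? : Dec P) → does P? ≡ true ⇔ P
does⇔ (yes p) = mk⇔ (λ _ → p) (λ _ → refl)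
does⇔ (no ¬p) = mk⇔ (λ ()) (λ p → contradiction p ¬p)

⟺-true : ∀ {b} {P : Set} → P → (b ⟺ P) ⇔ (b ≡ true)
⟺-true p = mk⇔ (λ b⇔P → Equivalence.from b⇔P p) (λ b≡ → mk⇔ (λ _ → p) (λ _ → b≡))

⟺-false : ∀ {b} {P : Set} → ¬ P → (b ⟺ P) ⇔ (b ≡ false)
⟺-false {false} ¬p = mk⇔ (λ _ → refl) (λ _ → mk⇔ (λ ()) (λ p → contradiction p ¬p))
⟺-false {true}  ¬p = mk⇔ (λ b⇔P → contradiction (Equivalence.to b⇔P refl) ¬p) (λ ())

⟺-cong : ∀ {b} {P Q : Set} → P ⇔ Q → (b ⟺ P) ⇔ (b ⟺ Q)
⟺-cong P⇔Q = mk⇔ (λ b⇔P → ⇔.trans b⇔P P⇔Q) (λ b⇔Q → ⇔.trans b⇔Q (⇔.sym P⇔Q))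

toSubset : ∀ {w} {P : Fin w → Set} → Decidable P → Subset w
toSubset P? = tabulate (does ∘ P?)

∈-toSubset : ∀ {w} {P : Fin w → Set} (P? : Decidable P) q → q ∈ toSubset P? ⇔ P q
∈-toSubset P? q = ⇔.trans (↔⇒⇔ []=↔lookup)
  (⇔.trans (mk⇔ (trans (sym (lookup∘tabulate _ q))) (trans (lookup∘tabulate _ q))) (does⇔ (P? q)))

-- Finite automata

Finite : Set → Set
Finite S = Σ ℕ λ m → Fin m ↔ S

finite-⊤ : Finite ⊤
finite-⊤ = 1 , 1↔⊤

finite-Bool : Finite Bool
finite-Bool = 2 , 2↔Bool

finite-Subset : ∀ w → Finite (Subset w)
finite-Subset w = _ , ↔-trans (Fin[m^n]↔Fin[m]^n 2 w) (↔-trans (lift↔ w 2↔Bool) (↔Vec w))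

finite-⊎ : {A B : Set} → Finite A → Finite B → Finite (A ⊎ B)
finite-⊎ (_ , A↔) (_ , B↔) = _ , ↔-trans +↔⊎ (A↔ ⊎-↔ B↔)

finite-× : {A B : Set} → Finite A → Finite B → Finite (A × B)
finite-× (_ , A↔) (_ , B↔) = _ , ↔-trans *↔× (A↔ ×-↔ B↔)

record Automaton (A : Set) : Set₁ where
  field
    State  : Set
    start  : State
    δ      : State → A → State
    Final  : State → Set
    final? : Decidable Final

  runFrom : State → List A → State
  runFrom q []      = q
  runFrom q (a ∷ x) = runFrom (δ q a) x

  Accepting : List A → Set
  Accepting x = Final (runFrom start x)

  acceptsFrom⇔ : (L : State → List A → Set) →
                 (∀ q → Final q ⇔ L q []) →
                 (∀ q a x → L (δ q a) x ⇔ L q (a ∷ x)) →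
                 ∀ q x → Final (runFrom q x) ⇔ L q x
  acceptsFrom⇔ L L-[] L-∷ q []      = L-[] q
  acceptsFrom⇔ L L-[] L-∷ q (a ∷ x) = ⇔.trans (acceptsFrom⇔ L L-[] L-∷ (δ q a) x) (L-∷ q a x)

open Automaton using (State; Accepting)

record Regular {A : Set} (P : List A → Set) : Set₁ where
  field
    automaton  : Automaton A
    finite     : Finite (State automaton)
    recognises : ∀ x → Accepting automaton x ⇔ P x

regular⇒DFA : {A : Set} {P : List A → Set} → Regular P →
              Σ (DFA A) λ M → ∀ x → Accepts M x ⇔ P x
regular⇒DFA {A} record { automaton = M ; finite = m , Fin↔State ; recognises = recognises } =
  D , λ x → ⇔.trans (accepts x) (recognises x)
  where
  open Automaton M
  open Inverse Fin↔State
  D : DFA A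
  D = record { states = m ; start = from start ; δ = λ i a → from (δ (to i) a)
             ; final = λ i → does (final? (to i)) }
  simulates : ∀ x q → runDFA D x (from q) ≡ from (runFrom q x)
  simulates []      q = refl
  simulates (a ∷ x) q rewrite strictlyInverseˡ q = simulates x (δ q a)
  accepts : ∀ x → Accepts D x ⇔ Final (runFrom start x)
  accepts x rewrite simulates x start | strictlyInverseˡ (runFrom start x) =
    does⇔ (final? (runFrom start x))

regular-by-residuals : {A : Set} (M : Automaton A) → Finite (State M) →
                       (L : State M → List A → Set) →
                       (∀ q → Automaton.Final M q ⇔ L q []) →
                       (∀ q a x → L (Automaton.δ M q a) x ⇔ L q (a ∷ x)) →
                       Regular (L (Automaton.start M))
regular-by-residuals M finite L L-[] L-∷ = record
  { automaton = M ; finite = finite ; recognises = Automaton.acceptsFrom⇔ M L L-[] L-∷ (Automaton.start M) }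

module _ {A : Set} where
  open Automaton

  regular-⇔ : {P Q : List A → Set} → (∀ x → P x ⇔ Q x) → Regular P → Regular Q
  regular-⇔ P⇔Q R = record { Regular R ; recognises = λ x → ⇔.trans (Regular.recognises R x) (P⇔Q x) }

  regular-∩ : {P Q : List A → Set} → Regular P → Regular Q → Regular (λ x → P x × Q x)
  regular-∩ R₁ R₂ = record
    { automaton  = M
    ; finite     = finite-× (Regular.finite R₁) (Regular.finite R₂)
    ; recognises = λ x → ⇔.trans (accepts-both x) (Regular.recognises R₁ x ×-⇔ Regular.recognises R₂ x)
    }
    where
    M₁ = Regular.automaton R₁
    M₂ = Regular.automaton R₂
    M : Automaton A
    M = record
      { State  = State M₁ × State M₂
      ; start  = start M₁ , start M₂
      ; δ      = λ (q₁ , q₂) a → δ M₁ q₁ a , δ M₂ q₂ a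
      ; Final  = λ (q₁ , q₂) → Final M₁ q₁ × Final M₂ q₂
      ; final? = λ (q₁ , q₂) → final? M₁ q₁ ×-dec final? M₂ q₂
      }
    accepts-both : ∀ x → Accepting M x ⇔ (Accepting M₁ x × Accepting M₂ x)
    accepts-both = acceptsFrom⇔ M (λ (q₁ , q₂) x → Final M₁ (runFrom M₁ q₁ x) × Final M₂ (runFrom M₂ q₂ x))
                     (λ _ → ⇔.refl) (λ _ _ _ → ⇔.refl) (start M)

  regular-map⁻¹ : {B : Set} {P : List B → Set} (h : A → B) → Regular P → Regular (P ∘ map h)
  regular-map⁻¹ h R = record
    { automaton  = M
    ; finite     = Regular.finite R
    ; recognises = λ x → ⇔.trans (pullback x) (Regular.recognises R (map h x))
    }
    where
    N = Regular.automaton R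
    M : Automaton A
    M = record { State = State N ; start = start N ; δ = λ q a → δ N q (h a)
               ; Final = Final N ; final? = final? N }
    pullback : ∀ x → Accepting M x ⇔ Accepting N (map h x)
    pullback = acceptsFrom⇔ M (λ q x → Final N (runFrom N q (map h x)))
                 (λ _ → ⇔.refl) (λ _ _ _ → ⇔.refl) (start M)

  regular-image : {C : Set} {P : List A → Set} (e : A → C) (e⁻¹ : C → Maybe A) →
                  (∀ a → e⁻¹ (e a) ≡ just a) → (∀ {c a} → e⁻¹ c ≡ just a → e a ≡ c) →
                  Regular P → Regular (λ x → Σ (List A) λ zs → x ≡ map e zs × P zs)
  regular-image {C} {P} e e⁻¹ e⁻¹∘e e∘e⁻¹ R = record
    { automaton  = M
    ; finite     = finite-⊎ finite-⊤ (Regular.finite R)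
    ; recognises = λ x → ⇔.trans (image x) (recognised x)
    }
    where
    N = Regular.automaton R
    M : Automaton C
    M = record
      { State  = ⊤ ⊎ State N
      ; start  = inj₂ (start N)
      ; δ      = λ { (inj₁ tt) c → inj₁ tt ; (inj₂ q) c → maybe′ (inj₂ ∘ δ N q) (inj₁ tt) (e⁻¹ c) }
      ; Final  = λ { (inj₁ tt) → ⊥ ; (inj₂ q) → Final N q }
      ; final? = λ { (inj₁ tt) → no λ () ; (inj₂ q) → final? N q }
      }
    Image : State M → List C → Set
    Image (inj₁ tt) x = ⊥
    Image (inj₂ q)  x = Σ (List A) λ zs → x ≡ map e zs × Final N (runFrom N q zs)
    image-[] : ∀ q → Final M q ⇔ Image q []
    image-[] (inj₁ tt) = mk⇔ (λ ()) (λ ())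
    image-[] (inj₂ q)  = mk⇔ (λ f → [] , refl , f) λ { ([] , refl , f) → f }
    e⁻¹-defined : ∀ {c a} → c ≡ e a → e⁻¹ c ≡ just a
    e⁻¹-defined refl = e⁻¹∘e _
    image-∷ : ∀ q c x → Image (δ M q c) x ⇔ Image q (c ∷ x)
    image-∷ (inj₁ tt) c x = mk⇔ (λ ()) (λ ())
    image-∷ (inj₂ q)  c x with e⁻¹ c in eq
    ... | just a  = mk⇔ (λ (zs , x≡ , f) → a ∷ zs , cong₂ _∷_ (sym (e∘e⁻¹ eq)) x≡ , f)
                        λ { (a′ ∷ zs , c∷x≡ , f) →
                              let c≡ , x≡ = ∷-injective c∷x≡
                                  a≡a′    = just-injective (trans (sym eq) (e⁻¹-defined c≡))
                              in zs , x≡ , subst (λ b → Final N (runFrom N (δ N q b) zs)) (sym a≡a′) f }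
    ... | nothing = mk⇔ (λ ()) λ { (a′ ∷ zs , c∷x≡ , _) →
                                     contradiction (trans (sym eq) (e⁻¹-defined (proj₁ (∷-injective c∷x≡)))) λ () }
    image : ∀ x → Accepting M x ⇔ Image (start M) x
    image = acceptsFrom⇔ M Image image-[] image-∷ (start M)
    recognised : ∀ x → Image (start M) x ⇔ (Σ (List A) λ zs → x ≡ map e zs × P zs)
    recognised x = mk⇔ (λ (zs , x≡ , f) → zs , x≡ , Equivalence.to (Regular.recognises R zs) f)
                       (λ (zs , x≡ , p) → zs , x≡ , Equivalence.from (Regular.recognises R zs) p)

-- States are sums and products of ⊤, Bool and Subset w, so that their finiteness can be
-- read off their type.  In the ODD automaton, after v φ′ records the right states and the
-- final flag of the last layer read; in the run automaton, reach S F records the set of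
-- ODD states reachable so far and the final states of the last layer read.
pattern fresh      = inj₁ tt
pattern dead       = inj₂ (inj₁ tt)
pattern symbols    = inj₂ (inj₂ (inj₁ tt))
pattern padding    = inj₂ (inj₂ (inj₂ tt))
pattern after v φ′ = inj₂ (inj₂ (v , φ′))
pattern reach S F  = inj₂ (S , F)

-- Padded strings

module _ {A : Set} where

  PaddedWord : List (Padded A) → Set
  PaddedWord ms = Σ (List A) λ s → NonEmpty s × ms ≡ pad (length ms) s

  PadState : Set
  PadState = ⊤ ⊎ ⊤ ⊎ ⊤ ⊎ ⊤

  PadFrom : PadState → List (Padded A) → Set
  PadFrom fresh   ms = PaddedWord ms
  PadFrom dead    ms = ⊥
  PadFrom symbols ms = Σ (List A) λ s → ms ≡ pad (length ms) s
  PadFrom padding ms = ms ≡ pad (length ms) []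

  padStep : PadState → Padded A → PadState
  padStep fresh   (just _) = symbols
  padStep fresh   nothing  = dead
  padStep symbols (just _) = symbols
  padStep symbols nothing  = padding
  padStep padding (just _) = dead
  padStep padding nothing  = padding
  padStep dead    _        = dead

  pad-automaton : Automaton (Padded A)
  pad-automaton = record
    { State  = PadState
    ; start  = fresh
    ; δ      = padStep
    ; Final  = λ { fresh → ⊥ ; dead → ⊥ ; symbols → ⊤ ; padding → ⊤ }
    ; final? = λ { fresh → no λ () ; dead → no λ () ; symbols → yes tt ; padding → yes tt }
    }

  paddedWord-regular : Regular PaddedWord
  paddedWord-regular = regular-by-residuals pad-automaton
    (finite-⊎ finite-⊤ (finite-⊎ finite-⊤ (finite-⊎ finite-⊤ finite-⊤)))
    PadFrom PadFrom-[] PadFrom-∷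
    where
    PadFrom-[] : ∀ q → Automaton.Final pad-automaton q ⇔ PadFrom q []
    PadFrom-[] fresh   = mk⇔ (λ ()) λ { (_ , (_ , _ , refl) , ()) }
    PadFrom-[] dead    = ⇔.refl
    PadFrom-[] symbols = mk⇔ (λ _ → [] , refl) (λ _ → tt)
    PadFrom-[] padding = mk⇔ (λ _ → refl) (λ _ → tt)
    PadFrom-∷ : ∀ q m ms → PadFrom (padStep q m) ms ⇔ PadFrom q (m ∷ ms)
    PadFrom-∷ fresh   (just a) ms = mk⇔ (λ (s , eq) → a ∷ s , (a , s , refl) , cong (just a ∷_) eq)
                                        λ { (_ ∷ s , _ , eq) → s , proj₂ (∷-injective eq) }
    PadFrom-∷ fresh   nothing  ms = mk⇔ (λ ()) λ { (_ , (_ , _ , refl) , ()) }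
    PadFrom-∷ symbols (just a) ms = mk⇔ (λ (s , eq) → a ∷ s , cong (just a ∷_) eq)
                                        λ { (_ ∷ s , eq) → s , proj₂ (∷-injective eq) }
    PadFrom-∷ symbols nothing  ms = mk⇔ (λ eq → [] , cong (nothing ∷_) eq)
                                        λ { ([] , eq) → proj₂ (∷-injective eq) }
    PadFrom-∷ padding (just a) ms = mk⇔ (λ ()) (λ ())
    PadFrom-∷ padding nothing  ms = mk⇔ (cong (nothing ∷_)) (proj₂ ∘ ∷-injective)
    PadFrom-∷ dead    _        ms = ⇔.refl

module _ {A B : Set} where

  align : List A → List B → List (A × Padded B)
  align []       _        = []
  align (x ∷ xs) []       = (x , nothing) ∷ align xs []
  align (x ∷ xs) (y ∷ ys) = (x , just y) ∷ align xs ys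

  map-proj₁-align : ∀ xs (ys : List B) → map proj₁ (align xs ys) ≡ xs
  map-proj₁-align []       _        = refl
  map-proj₁-align (x ∷ xs) []       = cong (x ∷_) (map-proj₁-align xs [])
  map-proj₁-align (x ∷ xs) (y ∷ ys) = cong (x ∷_) (map-proj₁-align xs ys)

  map-proj₂-align : ∀ xs ys → length ys ≤ length xs → map proj₂ (align xs ys) ≡ pad (length xs) ys
  map-proj₂-align []       []       _         = refl
  map-proj₂-align (x ∷ xs) []       _         = cong (nothing ∷_) (map-proj₂-align xs [] z≤n)
  map-proj₂-align (x ∷ xs) (y ∷ ys) (s≤s ys≤) = cong (just y ∷_) (map-proj₂-align xs ys ys≤)

  length-align : ∀ xs (ys : List B) → length (align xs ys) ≡ length xs
  length-align xs ys = trans (sym (length-map proj₁ (align xs ys))) (cong length (map-proj₁-align xs ys))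

  ⊗-align : ∀ xs ys → length ys ≤ length xs → xs ⊗ ys ≡ map (map₁ just) (align xs ys)
  ⊗-align []       []       _         = refl
  ⊗-align (x ∷ xs) []       _         = cong ((just x , nothing) ∷_) (⊗-align xs [] z≤n)
  ⊗-align (x ∷ xs) (y ∷ ys) (s≤s ys≤) = cong ((just x , just y) ∷_) (⊗-align xs ys ys≤)

  padded⇒align : ∀ zs ys → map proj₂ zs ≡ pad (length zs) ys → zs ≡ align (map proj₁ zs) ys
  padded⇒align []                   _         _  = refl
  padded⇒align ((x , nothing) ∷ zs) []        eq = cong ((x , nothing) ∷_) (padded⇒align zs [] (proj₂ (∷-injective eq)))
  padded⇒align ((x , just y) ∷ zs)  (y′ ∷ ys) eq with ∷-injective eq
  ... | refl , eq′ = cong ((x , just y) ∷_) (padded⇒align zs ys eq′)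

  padded⇒length≤ : ∀ (zs : List (A × Padded B)) ys → map proj₂ zs ≡ pad (length zs) ys → length ys ≤ length zs
  padded⇒length≤ _                   []        _  = z≤n
  padded⇒length≤ ((x , just y) ∷ zs) (y′ ∷ ys) eq = s≤s (padded⇒length≤ zs ys (proj₂ (∷-injective eq)))

  PairWords Convolutions : (List A → List (Padded B) → Set) → List (Padded A × Padded B) → Set
  PairWords Q x = Σ (List (A × Padded B)) λ zs → x ≡ map (map₁ just) zs ×
                    PaddedWord (map proj₂ zs) × Q (map proj₁ zs) (map proj₂ zs)
  Convolutions Q x = Σ (List A) λ xs → Σ (List B) λ ys →
                       NonEmpty ys × length ys ≤ length xs × x ≡ xs ⊗ ys × Q xs (pad (length xs) ys)

  pairWords⇔convolutions : ∀ Q x → PairWords Q x ⇔ Convolutions Q x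
  pairWords⇔convolutions Q x = mk⇔ convolution pairWord
    where
    convolution : PairWords Q x → Convolutions Q x
    convolution (zs , refl , (ys , ys⁺ , ms≡) , q) =
      map proj₁ zs , ys , ys⁺ , ys≤ , x≡ , subst (Q (map proj₁ zs)) ms≡′ q
      where
      ms≡ₖ = trans ms≡ (cong (λ k → pad k ys) (length-map proj₂ zs))
      ms≡′ = trans ms≡ₖ (cong (λ k → pad k ys) (sym (length-map proj₁ zs)))
      ys≤  = subst (length ys ≤_) (sym (length-map proj₁ zs)) (padded⇒length≤ zs ys ms≡ₖ)
      x≡   = trans (cong (map (map₁ just)) (padded⇒align zs ys ms≡ₖ)) (sym (⊗-align (map proj₁ zs) ys ys≤))
    pairWord : Convolutions Q x → PairWords Q x
    pairWord (xs , ys , ys⁺ , ys≤ , refl , q) =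
      align xs ys , ⊗-align xs ys ys≤ , (ys , ys⁺ , ms≡′) ,
      subst₂ Q (sym (map-proj₁-align xs ys)) (sym ms≡) q
      where
      ms≡  = map-proj₂-align xs ys ys≤
      ms≡′ = trans ms≡ (cong (λ k → pad k ys)
                         (sym (trans (length-map proj₂ (align xs ys)) (length-align xs ys))))

  unjust₁ : Padded A × B → Maybe (A × B)
  unjust₁ (a , b) = Maybe.map (_, b) a

  map₁-just-unjust₁ : ∀ {c z} → unjust₁ c ≡ just z → map₁ just z ≡ c
  map₁-just-unjust₁ {just a , b} refl = refl

-- Sequences of layers forming an ODD

module _ {A : Set} where

  ∀-Position-∷ : {P : ℕ → A → Set} {x : A} {xs : List A} →
                 (∀ i y → Position (x ∷ xs) i y → P i y) ⇔
                 (P 1 x × ∀ i y → Position xs i y → P (suc i) y)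
  ∀-Position-∷ {P} {x} {xs} = mk⇔ (λ h → h 1 x here , λ i y p → h (suc i) y (there p)) split
    where
    split : P 1 x × (∀ i y → Position xs i y → P (suc i) y) → ∀ i y → Position (x ∷ xs) i y → P i y
    split (P₁ , _) _ _ here      = P₁
    split (_ , Pₛ) _ _ (there p) = Pₛ _ _ p

  Position-1 : ∀ {xs : List A} {y} → Position xs 1 y → Σ (List A) λ ys → xs ≡ y ∷ ys
  Position-1 here = _ , refl

module _ {n w : ℕ} where
  open Layer

  rights : Layer n w → Subset w
  rights B = tabulate (r B)

  Follows : Subset w → Bool → Layer n w → Set
  Follows v φ′ B = φ′ ≡ false × ι B ≡ false × (∀ p → ℓ B p ≡ lookup v p)

  follows? : ∀ v φ′ B → Dec (Follows v φ′ B)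
  follows? v φ′ B = φ′ Bool.≟ false ×-dec ι B Bool.≟ false ×-dec all? (λ p → ℓ B p Bool.≟ lookup v p)

  Continues : Subset w → Bool → List (Layer n w) → Set
  Continues v φ′ []      = φ′ ≡ true
  Continues v φ′ (B ∷ D) = Follows v φ′ B × Continues (rights B) (φ B) D

  NonInitial : List (Layer n w) → Set
  NonInitial D = ∀ i B → Position D i B → ι B ≡ false

  LastFlags : List (Layer n w) → Set
  LastFlags D = ∀ i B → Position D i B → φ B ⟺ (i ≡ length D)

  firstFlags-∷ : ∀ {B D} → (∀ i B′ → Position (B ∷ D) i B′ → ι B′ ⟺ (i ≡ 1)) ⇔ (ι B ≡ true × NonInitial D)
  firstFlags-∷ = ⇔.trans ∀-Position-∷
    (⟺-true refl ×-⇔ mk⇔ (λ h i B p → to (⟺-false (1+i≢1 p)) (h i B p))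
                         (λ h i B p → from (⟺-false (1+i≢1 p)) (h i B p)))
    where
    open Equivalence
    1+i≢1 : ∀ {i D} {B : Layer n w} → Position D i B → suc i ≢ 1
    1+i≢1 here      ()
    1+i≢1 (there _) ()

  lastFlags-∷ : ∀ {B D} → LastFlags (B ∷ D) ⇔ ((φ B ⟺ (D ≡ [])) × LastFlags D)
  lastFlags-∷ {D = D} = ⇔.trans ∀-Position-∷
    (⟺-cong (1≡1+length D) ×-⇔ mk⇔ (λ h i B p → to (⟺-cong suc-≡⇔) (h i B p))
                                     (λ h i B p → from (⟺-cong suc-≡⇔) (h i B p)))
    where
    open Equivalence
    suc-≡⇔ : ∀ {i k} → (suc i ≡ suc k) ⇔ (i ≡ k)
    suc-≡⇔ = mk⇔ suc-injective (cong suc)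
    1≡1+length : ∀ (D : List (Layer n w)) → (1 ≡ suc (length D)) ⇔ (D ≡ [])
    1≡1+length []      = mk⇔ (λ _ → refl) (λ _ → refl)
    1≡1+length (_ ∷ _) = mk⇔ (λ ()) (λ ())

  continues⇔ : ∀ B D → (Chain (B ∷ D) × NonInitial D × LastFlags (B ∷ D)) ⇔ Continues (rights B) (φ B) D
  continues⇔ B [] = mk⇔ (λ (_ , _ , flags) → Equivalence.from (flags 1 B here) refl)
                        (λ φB → [ B ] , (λ _ _ ()) , λ { _ _ here → mk⇔ (λ _ → refl) (λ _ → φB) })
  continues⇔ B (B′ ∷ D) = mk⇔
    (λ { ((ℓ≡r ∷ chain) , nonInitial , flags) →
           let φB , flags′       = to lastFlags-∷ flags
               ιB′ , nonInitial′ = to (∀-Position-∷ {P = λ _ B → ι B ≡ false}) nonInitial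
           in (to (⟺-false λ ()) φB , ιB′ , λ p → trans (ℓ≡r p) (sym (lookup∘tabulate (r B) p))) ,
              to (continues⇔ B′ D) (chain , nonInitial′ , flags′) })
    (λ ((φB , ιB′ , ℓ≡r) , continues) →
           let chain , nonInitial′ , flags′ = from (continues⇔ B′ D) continues
           in ((λ p → trans (ℓ≡r p) (lookup∘tabulate (r B) p)) ∷ chain) ,
              from (∀-Position-∷ {P = λ _ B → ι B ≡ false}) (ιB′ , nonInitial′) ,
              from lastFlags-∷ (from (⟺-false λ ()) φB , flags′))
    where open Equivalence

  IsODD-∷ : ∀ B D → IsODD (B ∷ D) ⇔ (ι B ≡ true × Continues (rights B) (φ B) D)
  IsODD-∷ B D = mk⇔
    (λ (chain , flags) →
       let ιB , nonInitial = to firstFlags-∷ (λ i B′ p → proj₁ (flags i B′ p))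
       in ιB , to (continues⇔ B D) (chain , nonInitial , λ i B′ p → proj₂ (flags i B′ p)))
    (λ (ιB , continues) →
       let chain , nonInitial , lastFlags = from (continues⇔ B D) continues
           firstFlags                     = from firstFlags-∷ (ιB , nonInitial)
       in chain , λ i B′ p → firstFlags i B′ p , lastFlags i B′ p)
    where open Equivalence

  OddState : Set
  OddState = ⊤ ⊎ ⊤ ⊎ (Subset w × Bool)

  OddFrom : OddState → List (Layer n w) → Set
  OddFrom fresh        D = IsODD D
  OddFrom dead         D = ⊥
  OddFrom (after v φ′) D = Continues v φ′ D

  guard : {P : Set} → Dec P → OddState → OddState
  guard (yes _) q = q
  guard (no _)  _ = dead

  OddFrom-guard : ∀ {P : Set} (P? : Dec P) q D → OddFrom (guard P? q) D ⇔ (P × OddFrom q D)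
  OddFrom-guard (yes p) q D = mk⇔ (p ,_) proj₂
  OddFrom-guard (no ¬p) q D = mk⇔ (λ ()) (λ (p , _) → contradiction p ¬p)

  oddStep : OddState → Layer n w → OddState
  oddStep fresh        B = guard (ι B Bool.≟ true) (after (rights B) (φ B))
  oddStep dead         B = dead
  oddStep (after v φ′) B = guard (follows? v φ′ B) (after (rights B) (φ B))

  odd-automaton : Automaton (Layer n w)
  odd-automaton = record
    { State  = OddState
    ; start  = fresh
    ; δ      = oddStep
    ; Final  = λ { fresh → ⊤ ; dead → ⊥ ; (after _ φ′) → φ′ ≡ true }
    ; final? = λ { fresh → yes tt ; dead → no λ () ; (after _ φ′) → φ′ Bool.≟ true }
    }

  IsODD-regular : Regular IsODD
  IsODD-regular = regular-by-residuals odd-automaton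
    (finite-⊎ finite-⊤ (finite-⊎ finite-⊤ (finite-× (finite-Subset w) finite-Bool)))
    OddFrom OddFrom-[] OddFrom-∷
    where
    OddFrom-[] : ∀ q → Automaton.Final odd-automaton q ⇔ OddFrom q []
    OddFrom-[] fresh       = mk⇔ (λ _ → [] , λ _ _ ()) (λ _ → tt)
    OddFrom-[] dead        = ⇔.refl
    OddFrom-[] (after _ _) = ⇔.refl
    OddFrom-∷ : ∀ q B D → OddFrom (oddStep q B) D ⇔ OddFrom q (B ∷ D)
    OddFrom-∷ fresh        B D = ⇔.trans (OddFrom-guard (ι B Bool.≟ true) _ D) (⇔.sym (IsODD-∷ B D))
    OddFrom-∷ dead         B D = ⇔.refl
    OddFrom-∷ (after v φ′) B D = OddFrom-guard (follows? v φ′ B) _ D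

-- Accepting runs of an ODD

module _ {n w : ℕ} where
  open Layer

  InitialRun : List (Layer n w) → List (Padded (Fin n)) → Set
  InitialRun D ms = Σ (Fin w) λ p → Σ (Layer n w) λ B₁ →
    Position D 1 B₁ × I B₁ p ≡ true × RunFrom p D ms

  RunsFrom : Subset w → List (Layer n w × Padded (Fin n)) → Set
  RunsFrom S zs = Σ (Fin w) λ p → p ∈ S × RunFrom p (map proj₁ zs) (map proj₂ zs)

  initials finals : Layer n w → Subset w
  initials B = toSubset (λ p → I B p Bool.≟ true)
  finals   B = toSubset (λ q → F B q Bool.≟ true)

  successors : Subset w → Layer n w → Padded (Fin n) → Subset w
  successors S B m = toSubset (λ q → any? (λ p → p ∈? S ×-dec T B p m q Bool.≟ true))

  ∈-initials : ∀ B p → p ∈ initials B ⇔ I B p ≡ true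
  ∈-initials B = ∈-toSubset (λ p → I B p Bool.≟ true)

  ∈-finals : ∀ B q → q ∈ finals B ⇔ F B q ≡ true
  ∈-finals B = ∈-toSubset (λ q → F B q Bool.≟ true)

  ∈-successors : ∀ S B m q → q ∈ successors S B m ⇔ (Σ (Fin w) λ p → p ∈ S × T B p m q ≡ true)
  ∈-successors S B m = ∈-toSubset (λ q → any? (λ p → p ∈? S ×-dec T B p m q Bool.≟ true))

  RunState : Set
  RunState = ⊤ ⊎ (Subset w × Subset w)

  runStep : RunState → Layer n w × Padded (Fin n) → RunState
  runStep fresh       (B , m) = reach (successors (initials B) B m) (finals B)
  runStep (reach S _) (B , m) = reach (successors S B m) (finals B)

  run-automaton : Automaton (Layer n w × Padded (Fin n))
  run-automaton = record
    { State  = RunState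
    ; start  = fresh
    ; δ      = runStep
    ; Final  = λ { fresh → ⊥ ; (reach S F) → Σ (Fin w) λ q → q ∈ S × q ∈ F }
    ; final? = λ { fresh → no λ () ; (reach S F) → any? (λ q → q ∈? S ×-dec q ∈? F) }
    }

  ReachFrom : RunState → List (Layer n w × Padded (Fin n)) → Set
  ReachFrom fresh       zs       = InitialRun (map proj₁ zs) (map proj₂ zs)
  ReachFrom (reach S F) []       = Σ (Fin w) λ q → q ∈ S × q ∈ F
  ReachFrom (reach S _) (z ∷ zs) = RunsFrom S (z ∷ zs)

  ReachFrom-successors : ∀ S B m zs →
    ReachFrom (reach (successors S B m) (finals B)) zs ⇔ RunsFrom S ((B , m) ∷ zs)
  ReachFrom-successors S B m [] = mk⇔
    (λ (q , q∈ , q∈F) → let p , p∈S , t = to (∈-successors S B m q) q∈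
                        in p , p∈S , last t (to (∈-finals B q) q∈F))
    (λ { (p , p∈S , last {q = q} t f) → q , from (∈-successors S B m q) (p , p∈S , t) , from (∈-finals B q) f })
    where open Equivalence
  ReachFrom-successors S B m (z ∷ zs) = mk⇔
    (λ (q , q∈ , run) → let p , p∈S , t = to (∈-successors S B m q) q∈ in p , p∈S , step t run)
    (λ { (p , p∈S , step {q = q} t run) → q , from (∈-successors S B m q) (p , p∈S , t) , run })
    where open Equivalence

  InitialRun-regular : Regular (λ zs → InitialRun (map proj₁ zs) (map proj₂ zs))
  InitialRun-regular = regular-by-residuals run-automaton
    (finite-⊎ finite-⊤ (finite-× (finite-Subset w) (finite-Subset w)))
    ReachFrom ReachFrom-[] ReachFrom-∷
    where
    ReachFrom-[] : ∀ q → Automaton.Final run-automaton q ⇔ ReachFrom q []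
    ReachFrom-[] fresh       = mk⇔ (λ ()) λ { (_ , _ , () , _) }
    ReachFrom-[] (reach _ _) = ⇔.refl
    initial : ∀ B m zs → RunsFrom (initials B) ((B , m) ∷ zs) ⇔ ReachFrom fresh ((B , m) ∷ zs)
    initial B m zs = mk⇔
      (λ (p , p∈I , run) → p , B , here , Equivalence.to (∈-initials B p) p∈I , run)
      (λ { (p , _ , here , Ip , run) → p , Equivalence.from (∈-initials B p) Ip , run })
    ReachFrom-∷ : ∀ q z zs → ReachFrom (runStep q z) zs ⇔ ReachFrom q (z ∷ zs)
    ReachFrom-∷ fresh       (B , m) zs = ⇔.trans (ReachFrom-successors (initials B) B m zs) (initial B m zs)
    ReachFrom-∷ (reach S _) (B , m) zs = ReachFrom-successors S B m zs

module _ {n w : ℕ} where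

  ODDAccepts : List (Layer n w) → List (Padded (Fin n)) → Set
  ODDAccepts D ms = IsODD D × InitialRun D ms

  pairWords-regular : Regular (λ zs → PaddedWord (map proj₂ zs) × ODDAccepts (map proj₁ zs) (map proj₂ zs))
  pairWords-regular = regular-∩ (regular-map⁻¹ proj₂ paddedWord-regular)
                                (regular-∩ (regular-map⁻¹ proj₁ IsODD-regular) InitialRun-regular)

  convolutions⇔R∈ : ∀ x → Convolutions ODDAccepts x ⇔
    (Σ (List (Layer n w)) λ D → Σ (List (Fin n)) λ s → NonEmpty D × NonEmpty s × R∈ n w D s × (x ≡ D ⊗ s))
  convolutions⇔R∈ x = mk⇔
    (λ (D , s , s⁺ , s≤ , x≡ , odd , run@(_ , B₁ , B₁∈D , _)) →
       D , s , (B₁ , Position-1 B₁∈D) , s⁺ , (odd , s⁺ , s≤ , run) , x≡)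
    (λ (D , s , _ , s⁺ , (odd , _ , s≤ , run) , x≡) → D , s , s⁺ , s≤ , x≡ , odd , run)

proposition6 : (n w : ℕ) → 0 < w → RegularRel (R∈ n w)
proposition6 n w _ = regular⇒DFA (regular-⇔ (λ x → ⇔.trans (pairWords⇔convolutions ODDAccepts x) (convolutions⇔R∈ x))
  (regular-image (map₁ just) unjust₁ (λ _ → refl) map₁-just-unjust₁ pairWords-regular))
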